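{- Let $G$ be a connected graph and let $x$ be a vertex of $G$. Then ${\rm gp}(G-x)\leq 2\,{\rm gp}(G)$. Moreover, the bound is sharp: there exist connected graphs $G$ and vertices $x$ of $G$ with ${\rm gp}(G-x)=2\,{\rm gp}(G)$.
   Context: All graphs are simple. For a graph $G$, $d_G(u,v)$ is the number of edges of a shortest $u,v$-path in $G$ (a geodesic); if $u,v$ lie in different components there is no such path. A set $X\subseteq V(G)$ is a general position set of $G$ if for every pair of distinct $u,v\in X$ and every shortest $u,v$-path $P$ in $G$ we have $V(P)\cap X=\{u,v\}$ (equivalently, no three vertices of $X$ lie on a common shortest path of $G$). The general position number ${\rm gp}(G)$ is the maximum cardinality of a general position set of $G$. $G-x$ denotes the subgraph induced by $V(G)\setminus\{x\}$; it may be disconnected. -}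

module Defs where

open import Data.Nat using (ℕ; zero; suc; _≤_)
open import Data.Fin using (Fin; punchIn)
open import Data.Fin.Subset using (Subset; _∈_; ∣_∣)
open import Data.Bool using (Bool; true; false)
open import Data.Product using (Σ; ∃; _×_; _,_)
open import Data.Sum using (_⊎_)
open import Relation.Binary.PropositionalEquality using (_≡_; _≢_)

record Graph (n : ℕ) : Set where
  field
    adj   : Fin n → Fin n → Bool
    sym   : ∀ u v → adj u v ≡ adj v u
    irref : ∀ u → adj u u ≡ false
open Graph public

data Walk {n : ℕ} (G : Graph n) : Fin n → Fin n → ℕ → Set where
  []  : ∀ {u} → Walk G u u 0
  _∷_ : ∀ {u w v k} → adj G u w ≡ true → Walk G w v k → Walk G u v (suc k)

data _∈W_ {n : ℕ} {G : Graph n} (z : Fin n) : ∀ {u v k} → Walk G u v k → Set where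
  here-nil  : z ∈W ([] {u = z})
  here-cons : ∀ {w v k} {e : adj G z w ≡ true} {p : Walk G w v k} → z ∈W (e ∷ p)
  there     : ∀ {u w v k} {e : adj G u w ≡ true} {p : Walk G w v k} → z ∈W p → z ∈W (e ∷ p)

-- A shortest u,v-path (geodesic): a u,v-walk with the minimum number of edges.
-- (A walk of minimum length is automatically a path.)
IsGeodesic : ∀ {n} (G : Graph n) {u v k} → Walk G u v k → Set
IsGeodesic G {u} {v} {k} _ = ∀ m → Walk G u v m → k ≤ m

Connected : ∀ {n} → Graph n → Set
Connected {n} G = ∀ (u v : Fin n) → ∃ λ k → Walk G u v k

deleteVertex : ∀ {n} → Graph (suc n) → Fin (suc n) → Graph n
deleteVertex G x = record
  { adj   = λ i j → adj G (punchIn x i) (punchIn x j)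
  ; sym   = λ i j → sym G (punchIn x i) (punchIn x j)
  ; irref = λ i → irref G (punchIn x i)
  }

GeneralPosition : ∀ {n} → Graph n → Subset n → Set
GeneralPosition {n} G X =
  ∀ (u v : Fin n) → u ∈ X → v ∈ X → u ≢ v →
  ∀ {k} (P : Walk G u v k) → IsGeodesic G P →
  ∀ (z : Fin n) → z ∈ X → z ∈W P → (z ≡ u ⊎ z ≡ v)

IsGPNumber : ∀ {n} → Graph n → ℕ → Set
IsGPNumber {n} G k =
  (Σ (Subset n) λ X → GeneralPosition G X × ∣ X ∣ ≡ k) ×
  (∀ (X : Subset n) → GeneralPosition G X → ∣ X ∣ ≤ k)

{-# OPTIONS --safe #-}
module Submission where

-- Let S be a maximum general position set of G - x.  A geodesic of G joining two
-- vertices of S with a third vertex z of S in its interior must pass through x,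
-- since otherwise it would be a geodesic of G - x; then z lies on an x,u-geodesic
-- for one of its endpoints u.  Writing z ≺ u for this relation, the ≺-minimal
-- vertices of S are in general position in G, and so are the remaining ones: a
-- chain w ≺ z ≺ u puts z inside a w,u-geodesic of G that avoids x.  Hence S splits
-- into two general position sets of G.  For sharpness, gp(P₅) = 2 while deleting
-- the middle vertex of P₅ leaves 2K₂, whose four vertices are in general position.

open import Defs
open import Data.Bool using (true; _∨_) renaming (_≟_ to _≟ᵇ_)
open import Data.Bool.Properties using (∨-comm)
open import Data.Empty using (⊥)
open import Data.Fin as Fin using (Fin; zero; suc; toℕ; fromℕ<; punchIn; punchOut; #_; _<_)
open import Data.Fin.Properties
  using (any?; all?; toℕ<n; toℕ-injective; toℕ-fromℕ<; <⇒≢;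
         punchIn-injective; punchInᵢ≢i; punchIn-punchOut)
open import Data.Fin.Subset
  using (Subset; inside; outside; _∈_; _∉_; ∣_∣; _∩_; _∪_; ∁; ⁅_⁆; ⊤; Empty)
open import Data.Fin.Subset.Properties
  using (_∈?_; x∈p∩q⁻; x∈p∪q⁻; x∈⁅y⁆⇒x≡y; x∈∁p⇒x∉p; Empty-unique; ∣⊥∣≡0; ∣⊤∣≡n; ∣p∣≤n)
open import Data.Nat as ℕ using (ℕ; zero; suc; _+_; _*_; _∸_; _≤_; z≤n; s≤s)
open import Data.Nat.Properties
  using (≤-reflexive; ≤-trans; ≤-antisym; ≤-total; +-mono-≤; +-monoˡ-≤; +-cancelˡ-≤;
         +-cancelʳ-≡; +-assoc; +-comm; +-suc; +-identityʳ; m≤m+n; m≤n+m; m+[n∸m]≡n;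
         m+n≡0⇒m≡0; n≤0⇒n≡0; n≤1+n; 1+n≢n; <⇒≤; module ≤-Reasoning)
open import Data.Product using (Σ; ∃; ∃₂; _×_; _,_; proj₁; proj₂)
open import Data.Sum as Sum using (_⊎_; inj₁; inj₂; [_,_])
open import Data.Vec using ([]; _∷_; here; there; lookup; tabulate; insertAt)
open import Data.Vec.Properties
  using ([]=⇒lookup; lookup⇒[]=; lookup∘tabulate; insertAt-lookup; insertAt-punchIn)
open import Function using (_∘_)
open import Level using (Level)
open import Relation.Nullary using (¬_; Dec; yes; no; does; contradiction)
open import Relation.Nullary.Decidable as Dec
  using (_×-dec_; _→-dec_; ¬?; toWitness; dec-true; dec-false)
open import Relation.Unary using (Pred; Decidable)
open import Relation.Binary.PropositionalEquality as ≡
  using (_≡_; _≢_; refl; trans; cong; cong₂; subst)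

private
  variable
    ℓ : Level
    n : ℕ

least : {P : Pred ℕ ℓ} → Decidable P → ∀ {k} → P k → ∃ λ m → P m × (∀ {j} → P j → m ≤ j)
least P? {k} Pk with P? 0
... | yes P0 = 0 , P0 , λ _ → z≤n
least P? {zero}  P0 | no ¬P0 = contradiction P0 ¬P0
least P? {suc k} Pk | no ¬P0 with least (P? ∘ suc) Pk
... | m , Pm , min = suc m , Pm , λ { {zero} P0 → contradiction P0 ¬P0 ; {suc j} Pj → s≤s (min Pj) }

-- Walks

module _ {G : Graph n} where

  infixr 5 _++_

  _++_ : ∀ {u w v k m} → Walk G u w k → Walk G w v m → Walk G u v (k + m)
  []      ++ q = q
  (e ∷ p) ++ q = e ∷ (p ++ q)

  _∷ʳ_ : ∀ {u w v k} → Walk G u w k → adj G w v ≡ true → Walk G u v (suc k)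
  []       ∷ʳ e = e ∷ []
  (e′ ∷ p) ∷ʳ e = e′ ∷ (p ∷ʳ e)

  reverse : ∀ {u v k} → Walk G u v k → Walk G v u k
  reverse []                    = []
  reverse {u} (_∷_ {w = w} e p) = reverse p ∷ʳ trans (sym G w u) e

  walk-length-0 : ∀ {u v} → Walk G u v 0 → u ≡ v
  walk-length-0 [] = refl

  ∈-start : ∀ {u v k} (p : Walk G u v k) → u ∈W p
  ∈-start []      = here-nil
  ∈-start (e ∷ p) = here-cons

  ∈-[]⁻ : ∀ {z u} → z ∈W ([] {G = G} {u = u}) → z ≡ u
  ∈-[]⁻ here-nil = refl

  ∈-∷⁻ : ∀ {z u w v k} {e : adj G u w ≡ true} {p : Walk G w v k} →
         z ∈W (e ∷ p) → z ≡ u ⊎ z ∈W p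
  ∈-∷⁻ here-cons   = inj₁ refl
  ∈-∷⁻ (there z∈p) = inj₂ z∈p

  ∈-++⁺ʳ : ∀ {z u w v k m} (p : Walk G u w k) {q : Walk G w v m} → z ∈W q → z ∈W (p ++ q)
  ∈-++⁺ʳ []      z∈q = z∈q
  ∈-++⁺ʳ (e ∷ p) z∈q = there (∈-++⁺ʳ p z∈q)

  ∈-++⁻ : ∀ {z u w v k m} (p : Walk G u w k) {q : Walk G w v m} →
          z ∈W (p ++ q) → z ∈W p ⊎ z ∈W q
  ∈-++⁻ []      z∈q        = inj₂ z∈q
  ∈-++⁻ (e ∷ p) here-cons  = inj₁ here-cons
  ∈-++⁻ (e ∷ p) (there z∈) = Sum.map₁ there (∈-++⁻ p z∈)

  ∈-split : ∀ {z u v k} (p : Walk G u v k) → z ∈W p →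
            ∃₂ λ k₁ k₂ → Walk G u z k₁ × Walk G z v k₂ × k₁ + k₂ ≡ k
  ∈-split []      here-nil    = 0 , 0 , [] , [] , refl
  ∈-split (e ∷ p) here-cons   = 0 , _ , [] , e ∷ p , refl
  ∈-split (e ∷ p) (there z∈p) with ∈-split p z∈p
  ... | k₁ , k₂ , p₁ , p₂ , eq = suc k₁ , k₂ , e ∷ p₁ , p₂ , cong suc eq

  _∈W?_ : ∀ z {u v k} (p : Walk G u v k) → Dec (z ∈W p)
  _∈W?_ z {u} [] with z Fin.≟ u
  ... | yes refl = yes here-nil
  ... | no z≢u   = no (z≢u ∘ ∈-[]⁻)
  _∈W?_ z {u} (e ∷ p) with z Fin.≟ u | z ∈W? p
  ... | yes refl | _       = yes here-cons
  ... | no _     | yes z∈p = yes (there z∈p)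
  ... | no z≢u   | no z∉p  = no ([ z≢u , z∉p ] ∘ ∈-∷⁻)

  walk? : ∀ u v k → Dec (Walk G u v k)
  walk? u v zero with u Fin.≟ v
  ... | yes refl = yes []
  ... | no u≢v   = no (u≢v ∘ walk-length-0)
  walk? u v (suc k) with any? (λ w → (adj G u w ≟ᵇ true) ×-dec walk? w v k)
  ... | yes (w , e , p) = yes (e ∷ p)
  ... | no ∄w           = no λ { (e ∷ p) → ∄w (_ , e , p) }

-- Distance and betweenness

module Distance (G : Graph n) (connected : Connected G) where

  private
    shortestWalk : ∀ u v → ∃ λ m → Walk G u v m × (∀ {k} → Walk G u v k → m ≤ k)
    shortestWalk u v = least (walk? u v) (proj₂ (connected u v))

  d : Fin n → Fin n → ℕ
  d u v = proj₁ (shortestWalk u v)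

  shortest : ∀ u v → Walk G u v (d u v)
  shortest u v = proj₁ (proj₂ (shortestWalk u v))

  d-minimal : ∀ {u v k} → Walk G u v k → d u v ≤ k
  d-minimal {u} {v} = proj₂ (proj₂ (shortestWalk u v))

  shortest-geodesic : ∀ u v → IsGeodesic G (shortest u v)
  shortest-geodesic u v _ = d-minimal

  geodesic⇒≤d : ∀ {u v k} (p : Walk G u v k) → IsGeodesic G p → k ≤ d u v
  geodesic⇒≤d {u} {v} _ geo = geo _ (shortest u v)

  ≤d⇒geodesic : ∀ {u v k} (p : Walk G u v k) → k ≤ d u v → IsGeodesic G p
  ≤d⇒geodesic _ k≤d _ q = ≤-trans k≤d (d-minimal q)

  d≡0⇒≡ : ∀ {u v} → d u v ≡ 0 → u ≡ v
  d≡0⇒≡ {u} {v} eq = walk-length-0 (subst (Walk G u v) eq (shortest u v))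

  d-sym : ∀ u v → d u v ≡ d v u
  d-sym u v = ≤-antisym (d-minimal (reverse (shortest v u))) (d-minimal (reverse (shortest u v)))

  d-triangle : ∀ u w v → d u v ≤ d u w + d w v
  d-triangle u w v = d-minimal (shortest u w ++ shortest w v)

  record Between (u z v : Fin n) : Set where
    constructor between
    field d-additive : d u z + d z v ≡ d u v

  between? : ∀ u z v → Dec (Between u z v)
  between? u z v = Dec.map′ between Between.d-additive (d u z + d z v ℕ.≟ d u v)

  between-sym : ∀ {u z v} → Between u z v → Between v z u
  between-sym {u} {z} {v} (between uzv) = between (begin
    d v z + d z u ≡⟨ cong₂ _+_ (d-sym v z) (d-sym z u) ⟩
    d z v + d u z ≡⟨ +-comm (d z v) (d u z) ⟩
    d u z + d z v ≡⟨ uzv ⟩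
    d u v         ≡⟨ d-sym u v ⟩
    d v u         ∎)
    where open ≡.≡-Reasoning

  between-irrefl : ∀ {u z} → Between u z u → z ≡ u
  between-irrefl {u} {z} (between uzu) = ≡.sym (d≡0⇒≡ (m+n≡0⇒m≡0 (d u z) (trans uzu d-refl)))
    where
      d-refl : d u u ≡ 0
      d-refl = n≤0⇒n≡0 (d-minimal {u} [])

  between-distinct : ∀ {u z v} → z ≢ u → Between u z v → u ≢ v
  between-distinct z≢u uzv refl = z≢u (between-irrefl uzv)

  between-cancelˡ : ∀ {a b c e} → Between a b c → Between a c e → Between b c e
  between-cancelˡ {a} {b} {c} {e} (between abc) (between ace) = between (≤-antisym
    (+-cancelˡ-≤ (d a b) _ _ (begin
      d a b + (d b c + d c e) ≡⟨ ≡.sym (+-assoc (d a b) (d b c) (d c e)) ⟩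
      d a b + d b c + d c e   ≡⟨ cong (_+ d c e) abc ⟩
      d a c + d c e           ≡⟨ ace ⟩
      d a e                   ≤⟨ d-triangle a b e ⟩
      d a b + d b e           ∎))
    (d-triangle b c e))
    where open ≤-Reasoning

  between-antisym : ∀ {a b c} → Between a b c → Between b a c → a ≡ b
  between-antisym {a} {b} {c} (between abc) (between bac) =
    d≡0⇒≡ (+-cancelʳ-≡ (d b c) (d a b) 0 (trans abc ac≡bc))
    where
      ac≡bc : d a c ≡ d b c
      ac≡bc = ≤-antisym (≤-trans (m≤n+m (d a c) (d b a)) (≤-reflexive bac))
                        (≤-trans (m≤n+m (d b c) (d a b)) (≤-reflexive abc))

  geodesic-between : ∀ {u v z k} {p : Walk G u v k} → IsGeodesic G p → z ∈W p → Between u z v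
  geodesic-between {u} {v} {z} {k} {p} geo z∈p with ∈-split p z∈p
  ... | k₁ , k₂ , p₁ , p₂ , k₁+k₂≡k = between (≤-antisym
    (begin
      d u z + d z v ≤⟨ +-mono-≤ (d-minimal p₁) (d-minimal p₂) ⟩
      k₁ + k₂       ≡⟨ k₁+k₂≡k ⟩
      k             ≤⟨ geodesic⇒≤d p geo ⟩
      d u v         ∎)
    (d-triangle u z v))
    where open ≤-Reasoning

  between⇒geodesic : ∀ {u z v} → Between u z v → IsGeodesic G (shortest u z ++ shortest z v)
  between⇒geodesic {u} {z} {v} (between uzv) =
    ≤d⇒geodesic (shortest u z ++ shortest z v) (≤-reflexive uzv)

  ∈-shortest-++ : ∀ u z v → z ∈W (shortest u z ++ shortest z v)
  ∈-shortest-++ u z v = ∈-++⁺ʳ (shortest u z) (∈-start (shortest z v))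

  BetweenFree : Subset n → Set
  BetweenFree X = ∀ {u v z} → u ∈ X → v ∈ X → z ∈ X → z ≢ u → z ≢ v → ¬ Between u z v

  generalPosition⇒betweenFree : ∀ {X} → GeneralPosition G X → BetweenFree X
  generalPosition⇒betweenFree gp {u} {v} {z} u∈X v∈X z∈X z≢u z≢v uzv =
    [ z≢u , z≢v ] (gp u v u∈X v∈X (between-distinct z≢u uzv) _ (between⇒geodesic uzv)
                      z z∈X (∈-shortest-++ u z v))

  betweenFree⇒generalPosition : ∀ {X} → BetweenFree X → GeneralPosition G X
  betweenFree⇒generalPosition free u v u∈X v∈X _ p geo z z∈X z∈p with z Fin.≟ u | z Fin.≟ v
  ... | yes z≡u | _       = inj₁ z≡u
  ... | no _    | yes z≡v = inj₂ z≡v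
  ... | no z≢u  | no z≢v  =
    contradiction (geodesic-between geo z∈p) (free u∈X v∈X z∈X z≢u z≢v)

-- Vertex deletion

GeneralPositionAvoiding : Graph n → Fin n → Subset n → Set
GeneralPositionAvoiding G x X =
  ∀ {u v} → u ∈ X → v ∈ X → u ≢ v →
  ∀ {k} (p : Walk G u v k) → IsGeodesic G p → ¬ x ∈W p →
  ∀ {z} → z ∈ X → z ∈W p → z ≡ u ⊎ z ≡ v

∈-insertAt-outside⁻ : ∀ (S : Subset n) x {j} →
                      j ∈ insertAt S x outside → ∃ λ i → i ∈ S × punchIn x i ≡ j
∈-insertAt-outside⁻ S x {j} j∈ with x Fin.≟ j
... | yes refl = contradiction (trans (≡.sym (insertAt-lookup S x outside)) ([]=⇒lookup j∈)) λ ()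
... | no x≢j   = punchOut x≢j , lookup⇒[]= _ S lookup-i , punchIn-punchOut x≢j
  where
    S′ = insertAt S x outside
    lookup-i : lookup S (punchOut x≢j) ≡ inside
    lookup-i = begin
      lookup S (punchOut x≢j)                 ≡⟨ ≡.sym (insertAt-punchIn S x outside _) ⟩
      lookup S′ (punchIn x (punchOut x≢j))    ≡⟨ cong (lookup S′) (punchIn-punchOut x≢j) ⟩
      lookup S′ j                             ≡⟨ []=⇒lookup j∈ ⟩
      inside                                  ∎
      where open ≡.≡-Reasoning

x∉insertAt-outside : ∀ (S : Subset n) x → x ∉ insertAt S x outside
x∉insertAt-outside S x x∈ with ∈-insertAt-outside⁻ S x x∈
... | i , _ , eq = punchInᵢ≢i x i eq

∣insertAt-outside∣ : ∀ (S : Subset n) x → ∣ insertAt S x outside ∣ ≡ ∣ S ∣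
∣insertAt-outside∣ S             zero    = refl
∣insertAt-outside∣ (inside ∷ S)  (suc x) = cong suc (∣insertAt-outside∣ S x)
∣insertAt-outside∣ (outside ∷ S) (suc x) = ∣insertAt-outside∣ S x

module _ {G : Graph (suc n)} (x : Fin (suc n)) where

  private
    H : Graph n
    H = deleteVertex G x

  liftWalk : ∀ {a b k} → Walk H a b k → Walk G (punchIn x a) (punchIn x b) k
  liftWalk []      = []
  liftWalk (e ∷ p) = e ∷ liftWalk p

  lowerWalk : ∀ {u v k} (p : Walk G u v k) → ¬ x ∈W p →
              ∀ {u′ v′} → punchIn x u′ ≡ u → punchIn x v′ ≡ v →
              Σ (Walk H u′ v′ k) λ p′ → ∀ {z′} → punchIn x z′ ∈W p → z′ ∈W p′
  lowerWalk [] _ {u′} {v′} refl v′↦u with punchIn-injective x u′ v′ (≡.sym v′↦u)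
  ... | refl = [] , λ z∈ → subst (_∈W []) (≡.sym (punchIn-injective x _ u′ (∈-[]⁻ z∈))) here-nil
  lowerWalk (_∷_ {w = w} e p) x∉ {u′} refl v′↦v = e′ ∷ p′ , mem
    where
      x≢w : x ≢ w
      x≢w refl = x∉ (there (∈-start p))
      w′↦w = punchIn-punchOut x≢w
      lowered = lowerWalk p (x∉ ∘ there) w′↦w v′↦v
      p′ = proj₁ lowered
      e′ : adj H u′ (punchOut x≢w) ≡ true
      e′ = subst (λ t → adj G (punchIn x u′) t ≡ true) (≡.sym w′↦w) e
      mem : ∀ {z′} → punchIn x z′ ∈W (e ∷ p) → z′ ∈W (e′ ∷ p′)
      mem z∈ with ∈-∷⁻ z∈
      ... | inj₂ z∈p = there (proj₂ lowered z∈p)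
      ... | inj₁ z↦u with punchIn-injective x _ u′ z↦u
      ...   | refl = here-cons

  generalPosition-deleteVertex⇒avoiding : ∀ {S} → GeneralPosition H S →
                                          GeneralPositionAvoiding G x (insertAt S x outside)
  generalPosition-deleteVertex⇒avoiding {S} gp u∈ v∈ u≢v p geo x∉p z∈ z∈p
    with ∈-insertAt-outside⁻ S x u∈ | ∈-insertAt-outside⁻ S x v∈ | ∈-insertAt-outside⁻ S x z∈
  ... | u′ , u′∈S , refl | v′ , v′∈S , refl | z′ , z′∈S , refl =
    Sum.map (cong (punchIn x)) (cong (punchIn x))
      (gp u′ v′ u′∈S v′∈S (u≢v ∘ cong (punchIn x)) p′ geo′ z′ z′∈S (proj₂ lowered z∈p))
    where
      lowered = lowerWalk p x∉p refl refl
      p′ = proj₁ lowered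
      geo′ : IsGeodesic H p′
      geo′ m q = geo m (liftWalk q)

satisfying : {P : Pred (Fin n) ℓ} → Decidable P → Subset n
satisfying P? = tabulate (does ∘ P?)

∈-satisfying⁺ : {P : Pred (Fin n) ℓ} (P? : Decidable P) → ∀ {i} → P i → i ∈ satisfying P?
∈-satisfying⁺ P? {i} Pi =
  lookup⇒[]= i _ (trans (lookup∘tabulate (does ∘ P?) i) (dec-true (P? i) Pi))

∈-satisfying⁻ : {P : Pred (Fin n) ℓ} (P? : Decidable P) → ∀ {i} → i ∈ satisfying P? → P i
∈-satisfying⁻ P? {i} i∈ with P? i | trans (≡.sym (lookup∘tabulate (does ∘ P?) i)) ([]=⇒lookup i∈)
... | yes Pi | _ = Pi

∣p∣≡∣p∩q∣+∣p∩∁q∣ : ∀ (p q : Subset n) → ∣ p ∣ ≡ ∣ p ∩ q ∣ + ∣ p ∩ ∁ q ∣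
∣p∣≡∣p∩q∣+∣p∩∁q∣ []            []            = refl
∣p∣≡∣p∩q∣+∣p∩∁q∣ (outside ∷ p) (_ ∷ q)       = ∣p∣≡∣p∩q∣+∣p∩∁q∣ p q
∣p∣≡∣p∩q∣+∣p∩∁q∣ (inside ∷ p)  (inside ∷ q)  = cong suc (∣p∣≡∣p∩q∣+∣p∩∁q∣ p q)
∣p∣≡∣p∩q∣+∣p∩∁q∣ (inside ∷ p)  (outside ∷ q) =
  trans (cong suc (∣p∣≡∣p∩q∣+∣p∩∁q∣ p q)) (≡.sym (+-suc ∣ p ∩ q ∣ ∣ p ∩ ∁ q ∣))

noIncreasingPair⇒∣p∣≤1 : ∀ {p : Subset n} → (∀ {i j} → i < j → i ∈ p → j ∈ p → ⊥) → ∣ p ∣ ≤ 1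
noIncreasingPair⇒∣p∣≤1 {p = []}          _      = z≤n
noIncreasingPair⇒∣p∣≤1 {p = outside ∷ p} noPair =
  noIncreasingPair⇒∣p∣≤1 λ i<j i∈p j∈p → noPair (s≤s i<j) (there i∈p) (there j∈p)
noIncreasingPair⇒∣p∣≤1 {suc n} {p = inside ∷ p} noPair =
  s≤s (≤-reflexive (trans (cong ∣_∣ (Empty-unique p-empty)) (∣⊥∣≡0 n)))
  where
    p-empty : Empty p
    p-empty (j , j∈p) = noPair (s≤s z≤n) here (there j∈p)

noIncreasingTriple⇒∣p∣≤2 : ∀ {p : Subset n} →
                           (∀ {i j k} → i < j → j < k → i ∈ p → j ∈ p → k ∈ p → ⊥) → ∣ p ∣ ≤ 2
noIncreasingTriple⇒∣p∣≤2 {p = []}          _        = z≤n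
noIncreasingTriple⇒∣p∣≤2 {p = outside ∷ p} noTriple =
  noIncreasingTriple⇒∣p∣≤2 λ i<j j<k i∈p j∈p k∈p →
    noTriple (s≤s i<j) (s≤s j<k) (there i∈p) (there j∈p) (there k∈p)
noIncreasingTriple⇒∣p∣≤2 {p = inside ∷ p}  noTriple =
  s≤s (noIncreasingPair⇒∣p∣≤1 λ j<k j∈p k∈p →
    noTriple (s≤s z≤n) (s≤s j<k) here (there j∈p) (there k∈p))

-- The bound

module Shadows {G : Graph n} (connected : Connected G) {x : Fin n} {T : Subset n}
               (x∉T : x ∉ T) (gpT : GeneralPositionAvoiding G x T) where

  open Distance G connected

  infix 4 _≺_
  _≺_ : Fin n → Fin n → Set
  w ≺ u = w ≢ u × Between x w u

  interior-geodesic-via-x : ∀ {u v z} → u ∈ T → v ∈ T → z ∈ T → z ≢ u → z ≢ v →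
                            Between u z v → Between u x z ⊎ Between z x v
  interior-geodesic-via-x {u} {v} {z} u∈ v∈ z∈ z≢u z≢v uzv
    with x ∈W? (shortest u z ++ shortest z v)
  ... | yes x∈ = Sum.map (geodesic-between (shortest-geodesic u z))
                         (geodesic-between (shortest-geodesic z v))
                         (∈-++⁻ (shortest u z) x∈)
  ... | no x∉  = contradiction
    (gpT u∈ v∈ (between-distinct z≢u uzv) _ (between⇒geodesic uzv) x∉ z∈ (∈-shortest-++ u z v))
    [ z≢u , z≢v ]

  interior⇒≺ : ∀ {u v z} → u ∈ T → v ∈ T → z ∈ T → z ≢ u → z ≢ v →
               Between u z v → z ≺ u ⊎ z ≺ v
  interior⇒≺ u∈ v∈ z∈ z≢u z≢v uzv with interior-geodesic-via-x u∈ v∈ z∈ z≢u z≢v uzv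
  ... | inj₁ uxz = inj₂ (z≢v , between-cancelˡ uxz uzv)
  ... | inj₂ zxv = inj₁ (z≢u , between-cancelˡ (between-sym zxv) (between-sym uzv))

  ≺-chain-free : ∀ {w z u} → w ∈ T → z ∈ T → u ∈ T → w ≺ z → z ≺ u → ⊥
  ≺-chain-free w∈ z∈ u∈ (w≢z , xwz) (z≢u , xzu)
    with interior-geodesic-via-x w∈ u∈ z∈ (w≢z ∘ ≡.sym) z≢u (between-cancelˡ xwz xzu)
  ... | inj₁ wxz = x∉T (subst (_∈ T) (between-antisym wxz xwz) w∈)
  ... | inj₂ zxu = x∉T (subst (_∈ T) (between-antisym zxu xzu) z∈)

  Shadowed : Pred (Fin n) _
  Shadowed u = ∃ λ w → w ∈ T × w ≺ u

  shadowed? : Decidable Shadowed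
  shadowed? u = any? λ w → w ∈? T ×-dec ¬? (w Fin.≟ u) ×-dec between? x w u

  shadowed : Subset n
  shadowed = satisfying shadowed?

  ∈∁shadowed⇒¬Shadowed : ∀ {u} → u ∈ ∁ shadowed → ¬ Shadowed u
  ∈∁shadowed⇒¬Shadowed u∈ = x∈∁p⇒x∉p u∈ ∘ ∈-satisfying⁺ shadowed?

  generalPosition-unshadowed : GeneralPosition G (T ∩ ∁ shadowed)
  generalPosition-unshadowed = betweenFree⇒generalPosition λ u∈ v∈ z∈ z≢u z≢v uzv →
    let (u∈T , u∉) = x∈p∩q⁻ T _ u∈
        (v∈T , v∉) = x∈p∩q⁻ T _ v∈
        z∈T        = proj₁ (x∈p∩q⁻ T _ z∈)
    in [ (λ z≺u → ∈∁shadowed⇒¬Shadowed u∉ (_ , z∈T , z≺u))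
       , (λ z≺v → ∈∁shadowed⇒¬Shadowed v∉ (_ , z∈T , z≺v)) ]
       (interior⇒≺ u∈T v∈T z∈T z≢u z≢v uzv)

  generalPosition-shadowed : GeneralPosition G (T ∩ shadowed)
  generalPosition-shadowed = betweenFree⇒generalPosition λ u∈ v∈ z∈ z≢u z≢v uzv →
    let u∈T             = proj₁ (x∈p∩q⁻ T _ u∈)
        v∈T             = proj₁ (x∈p∩q⁻ T _ v∈)
        (z∈T , z∈)      = x∈p∩q⁻ T _ z∈
        (w , w∈T , w≺z) = ∈-satisfying⁻ shadowed? z∈
    in [ ≺-chain-free w∈T z∈T u∈T w≺z , ≺-chain-free w∈T z∈T v∈T w≺z ]
       (interior⇒≺ u∈T v∈T z∈T z≢u z≢v uzv)

gp-deleteVertex≤2*gp : {G : Graph (suc n)} → Connected G → ∀ x {a b} →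
                       IsGPNumber G a → IsGPNumber (deleteVertex G x) b → b ≤ 2 * a
gp-deleteVertex≤2*gp connected x {a} (_ , gp≤a) ((S , gpS , refl) , _) = begin
  ∣ S ∣                                 ≡⟨ ≡.sym (∣insertAt-outside∣ S x) ⟩
  ∣ T ∣                                 ≡⟨ ∣p∣≡∣p∩q∣+∣p∩∁q∣ T shadowed ⟩
  ∣ T ∩ shadowed ∣ + ∣ T ∩ ∁ shadowed ∣ ≤⟨ +-mono-≤ (gp≤a _ generalPosition-shadowed)
                                                   (gp≤a _ generalPosition-unshadowed) ⟩
  a + a                                 ≡⟨ cong (a +_) (≡.sym (+-identityʳ a)) ⟩
  2 * a                                 ∎
  where
    open ≤-Reasoning
    T = insertAt S x outside
    open Shadows connected (x∉insertAt-outside S x) (generalPosition-deleteVertex⇒avoiding x gpS)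

-- Paths and sharpness

path : ∀ n → Graph n
path n = record
  { adj   = λ i j → does (suc (toℕ i) ℕ.≟ toℕ j) ∨ does (suc (toℕ j) ℕ.≟ toℕ i)
  ; sym   = λ i j → ∨-comm (does (suc (toℕ i) ℕ.≟ toℕ j)) _
  ; irref = λ i → let i+1≢i = dec-false (suc (toℕ i) ℕ.≟ toℕ i) 1+n≢n in cong₂ _∨_ i+1≢i i+1≢i
  }

path-adj-rise : ∀ {u w : Fin n} → adj (path n) u w ≡ true → toℕ w ≤ suc (toℕ u)
path-adj-rise {u = u} {w} = rise (suc (toℕ u) ℕ.≟ toℕ w) (suc (toℕ w) ℕ.≟ toℕ u)
  where
    rise : (a : Dec (suc (toℕ u) ≡ toℕ w)) (b : Dec (suc (toℕ w) ≡ toℕ u)) →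
           does a ∨ does b ≡ true → toℕ w ≤ suc (toℕ u)
    rise (yes u+1≡w) _           _ = ≤-reflexive (≡.sym u+1≡w)
    rise (no _)      (yes w+1≡u) _ =
      ≤-trans (n≤1+n (toℕ w)) (≤-trans (≤-reflexive w+1≡u) (n≤1+n (toℕ u)))

path-walk-rise : ∀ {u v : Fin n} {k} → Walk (path n) u v k → toℕ v ≤ toℕ u + k
path-walk-rise {u = u} []                              = m≤m+n (toℕ u) 0
path-walk-rise {u = u} {v} {suc k} (_∷_ {w = w} e p) = begin
  toℕ v           ≤⟨ path-walk-rise p ⟩
  toℕ w + k       ≤⟨ +-monoˡ-≤ k (path-adj-rise e) ⟩
  suc (toℕ u) + k ≡⟨ ≡.sym (+-suc (toℕ u) k) ⟩
  toℕ u + suc k   ∎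
  where open ≤-Reasoning

ascend : ∀ {i j : Fin n} k → toℕ i + k ≡ toℕ j → Walk (path n) i j k
ascend {i = i} zero i+0≡j =
  subst (λ j → Walk (path _) i j 0) (toℕ-injective (trans (≡.sym (+-identityʳ (toℕ i))) i+0≡j)) []
ascend {n} {i} {j} (suc k) i+k+1≡j = step ∷ ascend k next+k≡j
  where
    i+1+k≡j : suc (toℕ i) + k ≡ toℕ j
    i+1+k≡j = trans (≡.sym (+-suc (toℕ i) k)) i+k+1≡j
    next<n : suc (toℕ i) ℕ.< n
    next<n = ≤-trans (s≤s (≤-trans (m≤m+n (suc (toℕ i)) k) (≤-reflexive i+1+k≡j))) (toℕ<n j)
    next : Fin n
    next = fromℕ< next<n
    step : adj (path n) i next ≡ true
    step = cong (_∨ does (suc (toℕ next) ℕ.≟ toℕ i))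
                (dec-true (suc (toℕ i) ℕ.≟ toℕ next) (≡.sym (toℕ-fromℕ< next<n)))
    next+k≡j : toℕ next + k ≡ toℕ j
    next+k≡j = trans (cong (_+ k) (toℕ-fromℕ< next<n)) i+1+k≡j

path-connected : Connected (path n)
path-connected u v with ≤-total (toℕ u) (toℕ v)
... | inj₁ u≤v = _ , ascend _ (m+[n∸m]≡n u≤v)
... | inj₂ v≤u = _ , reverse (ascend _ (m+[n∸m]≡n v≤u))

module _ {n : ℕ} where

  open Distance (path n) path-connected

  path-d : ∀ {u v : Fin n} {k} → toℕ u + k ≡ toℕ v → d u v ≡ k
  path-d {u} {v} {k} u+k≡v = ≤-antisym (d-minimal (ascend k u+k≡v))
    (+-cancelˡ-≤ (toℕ u) _ _
      (subst (_≤ toℕ u + d u v) (≡.sym u+k≡v) (path-walk-rise (shortest u v))))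

  path-between : ∀ {i j k : Fin n} → i Fin.≤ j → j Fin.≤ k → Between i j k
  path-between {i} {j} {k} i≤j j≤k = between (begin
    d i j + d j k                     ≡⟨ cong₂ _+_ (path-d {i} (m+[n∸m]≡n i≤j))
                                                   (path-d {j} (m+[n∸m]≡n j≤k)) ⟩
    (toℕ j ∸ toℕ i) + (toℕ k ∸ toℕ j) ≡⟨ ≡.sym (path-d {i} i+steps≡k) ⟩
    d i k                             ∎)
    where
      open ≡.≡-Reasoning
      i+steps≡k : toℕ i + ((toℕ j ∸ toℕ i) + (toℕ k ∸ toℕ j)) ≡ toℕ k
      i+steps≡k = trans (≡.sym (+-assoc (toℕ i) _ _))
                        (trans (cong (_+ (toℕ k ∸ toℕ j)) (m+[n∸m]≡n i≤j)) (m+[n∸m]≡n j≤k))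

  path-gp≤2 : ∀ {X} → GeneralPosition (path n) X → ∣ X ∣ ≤ 2
  path-gp≤2 gp = noIncreasingTriple⇒∣p∣≤2 λ i<j j<k i∈ j∈ k∈ →
    generalPosition⇒betweenFree gp i∈ k∈ j∈ (<⇒≢ i<j ∘ ≡.sym) (<⇒≢ j<k)
      (path-between (<⇒≤ i<j) (<⇒≤ j<k))

IsCluster : Graph n → Set
IsCluster G = ∀ {u w v} → adj G u w ≡ true → adj G w v ≡ true → u ≢ v → adj G u v ≡ true

module _ {G : Graph n} (cluster : IsCluster G) where

  walk⇒adj : ∀ {u v k} → Walk G u v k → u ≢ v → adj G u v ≡ true
  walk⇒adj []                        u≢u = contradiction refl u≢u
  walk⇒adj {v = v} (_∷_ {w = w} e p) u≢v with w Fin.≟ v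
  ... | yes refl = e
  ... | no w≢v   = cluster e (walk⇒adj p w≢v) u≢v

  cluster⇒generalPosition : ∀ X → GeneralPosition G X
  cluster⇒generalPosition _ u v _ _ u≢v p geo z _ z∈p =
    ends p (geo 1 (walk⇒adj p u≢v ∷ [])) z∈p
    where
      ends : ∀ {u v k z} (p : Walk G u v k) → k ≤ 1 → z ∈W p → z ≡ u ⊎ z ≡ v
      ends []            _        here-nil         = inj₁ refl
      ends (_ ∷ [])      _        here-cons        = inj₁ refl
      ends (_ ∷ [])      _        (there here-nil) = inj₂ refl
      ends (_ ∷ (_ ∷ _)) (s≤s ()) _

∈-pair⁻ : ∀ {a b i : Fin n} → i ∈ ⁅ a ⁆ ∪ ⁅ b ⁆ → i ≡ a ⊎ i ≡ b
∈-pair⁻ {a = a} {b} i∈ = Sum.map (x∈⁅y⁆⇒x≡y a) (x∈⁅y⁆⇒x≡y b) (x∈p∪q⁻ ⁅ a ⁆ ⁅ b ⁆ i∈)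

pair-generalPosition : ∀ (G : Graph n) a b → GeneralPosition G (⁅ a ⁆ ∪ ⁅ b ⁆)
pair-generalPosition _ _ _ u v u∈ v∈ u≢v _ _ z z∈ _ with ∈-pair⁻ u∈ | ∈-pair⁻ v∈ | ∈-pair⁻ z∈
... | inj₁ refl | inj₁ refl | _         = contradiction refl u≢v
... | inj₂ refl | inj₂ refl | _         = contradiction refl u≢v
... | inj₁ refl | inj₂ refl | inj₁ refl = inj₁ refl
... | inj₁ refl | inj₂ refl | inj₂ refl = inj₂ refl
... | inj₂ refl | inj₁ refl | inj₁ refl = inj₂ refl
... | inj₂ refl | inj₁ refl | inj₂ refl = inj₁ refl

gp-P₅ : IsGPNumber (path 5) 2
gp-P₅ = (⁅ # 0 ⁆ ∪ ⁅ # 4 ⁆ , pair-generalPosition (path 5) (# 0) (# 4) , refl) , λ _ → path-gp≤2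

P₅-minus-middle-cluster : IsCluster (deleteVertex (path 5) (# 2))
P₅-minus-middle-cluster {u} {w} {v} = toWitness {a? = cluster?} _ u w v
  where
    H = deleteVertex (path 5) (# 2)
    cluster? = all? λ u → all? λ w → all? λ v →
      (adj H u w ≟ᵇ true) →-dec (adj H w v ≟ᵇ true) →-dec ¬? (u Fin.≟ v) →-dec (adj H u v ≟ᵇ true)

gp-P₅-minus-middle : IsGPNumber (deleteVertex (path 5) (# 2)) 4
gp-P₅-minus-middle =
  (⊤ , cluster⇒generalPosition P₅-minus-middle-cluster ⊤ , ∣⊤∣≡n 4) , λ X _ → ∣p∣≤n X

theorem3p1 :
    ((n : ℕ) (G : Graph (suc n)) → Connected G → (x : Fin (suc n)) →
      ∀ (a b : ℕ) → IsGPNumber G a → IsGPNumber (deleteVertex G x) b → b ≤ 2 * a)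
    ×
    (Σ ℕ λ n → Σ (Graph (suc n)) λ G → Σ (Fin (suc n)) λ x → Σ ℕ λ a → Σ ℕ λ b →
      Connected G × IsGPNumber G a × IsGPNumber (deleteVertex G x) b × b ≡ 2 * a)
theorem3p1 =
  (λ _ _ connected x _ _ → gp-deleteVertex≤2*gp connected x) ,
  (4 , path 5 , # 2 , 2 , 4 , path-connected , gp-P₅ , gp-P₅-minus-middle , refl)
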